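{- Let $G=(V,E)$ be a connected simple undirected graph with adjacency matrix $A$ and Perron eigenvector $\nu$, and let $\mathcal{P}$ be a weight-equitable partition of $V$. Let $X_{\mathcal{P}}\in\mathbb{R}^{n\times n}$ be the matrix with entries $x_{vv'}=\frac{\nu_v\nu_{v'}}{\|\rho(P)\|^2}$ if $v,v'\in P$ for some $P\in\mathcal{P}$, and $x_{vv'}=0$ otherwise. Then $X_{\mathcal{P}}A=AX_{\mathcal{P}}$.
   Context: Let $V=[n]$. The Perron eigenvector $\nu=(\nu_1,\dots,\nu_n)^\top$ is the positive eigenvector of $A$ for its largest eigenvalue (simple since $G$ is connected), normalized to have minimum entry $1$. For $U\subseteq V$, $\|\rho(U)\|^2=\sum_{u\in U}\nu_u^2$. For a partition $\{V_1,\dots,V_m\}$ of $V$ and $u\in V_i$, the weight-intersection number is $b^*_{ij}(u)=\frac{1}{\nu_u}\sum_{v\in V_j,\,v\sim u}\nu_v$; the partition is weight-equitable if $b^*_{ij}(u)=b^*_{ij}(v)$ for all $i,j$ and all $u,v\in V_i$. -}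

module Defs where

open import Level using (Level; _⊔_; suc)
open import Data.Nat using (ℕ; zero) renaming (suc to sucℕ)
open import Data.Fin using (Fin; _≟_) renaming (zero to fz; suc to fs)
open import Data.Product using (Σ; ∃; _×_; _,_)
open import Data.Sum using (_⊎_)
open import Data.Bool using (Bool; true; false; if_then_else_)
open import Relation.Nullary using (¬_; Dec; yes; no)
open import Relation.Binary.PropositionalEquality using (_≡_)
open import Algebra.Bundles using (CommutativeRing)

-- The real numbers, axiomatised as a complete ordered field
-- (any two such are isomorphic, so this is "ℝ").

record CompleteOrderedField (c ℓ : Level) : Set (suc (c ⊔ ℓ)) where
  field
    commutativeRing : CommutativeRing c ℓ
  open CommutativeRing commutativeRing public
  field
    _≤_       : Carrier → Carrier → Set ℓ
    ≤-refl    : ∀ {x} → x ≤ x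
    ≤-trans   : ∀ {x y z} → x ≤ y → y ≤ z → x ≤ z
    ≤-antisym : ∀ {x y} → x ≤ y → y ≤ x → x ≈ y
    ≤-total   : ∀ x y → (x ≤ y) ⊎ (y ≤ x)
    ≤-resp-≈  : ∀ {x x' y y'} → x ≈ x' → y ≈ y' → x ≤ y → x' ≤ y'
    +-mono-≤  : ∀ {x y} z → x ≤ y → (x + z) ≤ (y + z)
    *-nonneg  : ∀ {x y} → 0# ≤ x → 0# ≤ y → 0# ≤ (x * y)
    0≉1       : ¬ (0# ≈ 1#)
    _⁻¹       : Carrier → Carrier
    ⁻¹-inverse : ∀ x → ¬ (x ≈ 0#) → (x * (x ⁻¹)) ≈ 1#
    sup : ∀ (S : Carrier → Set ℓ) → (∃ λ x → S x) → (∃ λ b → ∀ x → S x → x ≤ b) →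
          ∃ λ s → (∀ x → S x → x ≤ s) × (∀ b → (∀ x → S x → x ≤ b) → s ≤ b)

  _<_ : Carrier → Carrier → Set ℓ
  x < y = (x ≤ y) × ¬ (x ≈ y)

  _/_ : Carrier → Carrier → Carrier
  x / y = x * (y ⁻¹)

record Graph (n : ℕ) : Set₁ where
  field
    _~_     : Fin n → Fin n → Set
    ~-dec   : ∀ u v → Dec (u ~ v)
    ~-sym   : ∀ {u v} → u ~ v → v ~ u
    ~-irrefl : ∀ {u} → ¬ (u ~ u)

module _ {n : ℕ} (G : Graph n) where
  open Graph G

  data Reachable : Fin n → Fin n → Set where
    here : ∀ {u} → Reachable u u
    step : ∀ {u v w} → u ~ v → Reachable v w → Reachable u w

  Connected : Set
  Connected = ∀ u v → Reachable u v

record Partition (n m : ℕ) : Set where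
  field
    part     : Fin n → Fin m
    nonempty : ∀ i → ∃ λ u → part u ≡ i

module LinAlg {c ℓ : Level} (F : CompleteOrderedField c ℓ) where
  open CompleteOrderedField F

  sumF : ∀ {n} → (Fin n → Carrier) → Carrier
  sumF {zero}   f = 0#
  sumF {sucℕ n} f = f fz + sumF (λ i → f (fs i))

  Vector : ℕ → Set c
  Vector n = Fin n → Carrier

  Matrix : ℕ → Set c
  Matrix n = Fin n → Fin n → Carrier

  _·_ : ∀ {n} → Matrix n → Matrix n → Matrix n
  (M · N) i j = sumF (λ k → M i k * N k j)

  _▸_ : ∀ {n} → Matrix n → Vector n → Vector n
  (M ▸ x) i = sumF (λ k → M i k * x k)

  adjacency : ∀ {n} → Graph n → Matrix n
  adjacency G u v with Graph.~-dec G u v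
  ... | yes _ = 1#
  ... | no  _ = 0#

  IsEigenpair : ∀ {n} → Matrix n → Carrier → Vector n → Set ℓ
  IsEigenpair M λ' x = (¬ (∀ i → x i ≈ 0#)) × (∀ i → (M ▸ x) i ≈ (λ' * x i))

  IsPerronEigenvector : ∀ {n} → Graph n → Vector n → Set (c ⊔ ℓ)
  IsPerronEigenvector G ν =
    Σ Carrier λ λ₁ →
      IsEigenpair (adjacency G) λ₁ ν
      × (∀ μ x → IsEigenpair (adjacency G) μ x → μ ≤ λ₁)
      × (∀ u → 0# < ν u)
      × (∀ u → 1# ≤ ν u)
      × (∃ λ u → ν u ≈ 1#)

  module _ {n m : ℕ} (P : Partition n m) where
    open Partition P

    inPart : Fin n → Fin m → Carrier
    inPart u j with part u ≟ j
    ... | yes _ = 1#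
    ... | no  _ = 0#

    normSq : Vector n → Fin m → Carrier
    normSq ν j = sumF (λ u → inPart u j * (ν u * ν u))

    weightIntersection : Graph n → Vector n → Fin n → Fin m → Carrier
    weightIntersection G ν u j =
      (sumF (λ v → inPart v j * (adjacency G u v * ν v))) / ν u

    IsWeightEquitable : Graph n → Vector n → Set ℓ
    IsWeightEquitable G ν =
      ∀ u v j → part u ≡ part v →
        weightIntersection G ν u j ≈ weightIntersection G ν v j

    XP : Vector n → Matrix n
    XP ν v v' with part v ≟ part v'
    ... | yes _ = (ν v * ν v') / normSq ν (part v)
    ... | no  _ = 0#

{-# OPTIONS --safe #-}
-- Write i and j for the parts of v and w, S(u, j) = Σ_{x ∈ V_j, x ∼ u} ν_x and
-- N_i = ‖ρ(V_i)‖². Then (X A)_{vw} = ν_v ν_w b*_{wi} / N_i, and since both A and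
-- X are symmetric, (A X)_{vw} = (X A)_{wv}; so the claim is that b*_{wi} / N_i
-- is symmetric in (v, w). Weight-equitability makes b*_{ji} constant on V_j, hence
-- N_j b*_{ji} = Σ_{u ∈ V_j} ν_u S(u, i) = Σ_{u ∈ V_j, x ∈ V_i, u ∼ x} ν_u ν_x,
-- which is symmetric in (i, j) because the adjacency relation is.
module Submission where

open import Defs
open import Level using (Level)
open import Data.Nat using (ℕ; zero; suc)
open import Data.Fin using (Fin; _≟_) renaming (zero to fz; suc to fs)
open import Data.Product using (_,_; proj₁; proj₂)
open import Data.Empty using (⊥-elim)
open import Function using (_∘_)
open import Relation.Nullary using (¬_; yes; no)
open import Relation.Binary.PropositionalEquality as ≡ using (_≡_)
import Algebra.Properties.Semiring.Sum as SemiringSum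
import Algebra.Solver.CommutativeMonoid as CommutativeMonoidSolver

module _ {c ℓ : Level} (F : CompleteOrderedField c ℓ) where
  open CompleteOrderedField F
  open LinAlg F
  open SemiringSum semiring using (sum; sum-cong-≋; ∑-comm; *-distribˡ-sum; *-distribʳ-sum)
  open CommutativeMonoidSolver *-commutativeMonoid using (solve; _⊜_; _⊕_)
  open import Relation.Binary.Reasoning.Setoid setoid

  x*[y/x]≈y : ∀ {x} y → ¬ x ≈ 0# → x * (y / x) ≈ y
  x*[y/x]≈y {x} y x≉0 = begin
    x * (y * x ⁻¹)   ≈⟨ solve 3 (λ a b c → a ⊕ (b ⊕ c) ⊜ b ⊕ (a ⊕ c)) refl x y (x ⁻¹) ⟩
    y * (x * x ⁻¹)   ≈⟨ *-congˡ (⁻¹-inverse x x≉0) ⟩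
    y * 1#           ≈⟨ *-identityʳ y ⟩
    y                ∎

  *-nonzero : ∀ {x y} → ¬ x ≈ 0# → ¬ y ≈ 0# → ¬ x * y ≈ 0#
  *-nonzero {x} {y} x≉0 y≉0 xy≈0 = y≉0 (begin
    y                ≈⟨ x*[y/x]≈y y x≉0 ⟨
    x * (y * x ⁻¹)   ≈⟨ solve 3 (λ a b c → a ⊕ (b ⊕ c) ⊜ (a ⊕ b) ⊕ c) refl x y (x ⁻¹) ⟩
    (x * y) * x ⁻¹   ≈⟨ *-congʳ xy≈0 ⟩
    0# * x ⁻¹        ≈⟨ zeroˡ _ ⟩
    0#               ∎)

  /-cross : ∀ {x y z t} → ¬ y ≈ 0# → ¬ t ≈ 0# → x * t ≈ z * y → x / y ≈ z / t
  /-cross {x} {y} {z} {t} y≉0 t≉0 xt≈zy = begin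
    x * y ⁻¹                   ≈⟨ *-identityʳ _ ⟨
    (x * y ⁻¹) * 1#            ≈⟨ *-congˡ (⁻¹-inverse t t≉0) ⟨
    (x * y ⁻¹) * (t * t ⁻¹)    ≈⟨ solve 4 (λ a b c d → (a ⊕ b) ⊕ (c ⊕ d) ⊜ (a ⊕ c) ⊕ (b ⊕ d)) refl x (y ⁻¹) t (t ⁻¹) ⟩
    (x * t) * (y ⁻¹ * t ⁻¹)    ≈⟨ *-congʳ xt≈zy ⟩
    (z * y) * (y ⁻¹ * t ⁻¹)    ≈⟨ solve 4 (λ a b c d → (a ⊕ b) ⊕ (c ⊕ d) ⊜ (a ⊕ d) ⊕ (b ⊕ c)) refl z y (y ⁻¹) (t ⁻¹) ⟩
    (z * t ⁻¹) * (y * y ⁻¹)    ≈⟨ *-congˡ (⁻¹-inverse y y≉0) ⟩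
    (z * t ⁻¹) * 1#            ≈⟨ *-identityʳ _ ⟩
    z * t ⁻¹                   ∎

  sumF≡sum : ∀ {n} (f : Vector n) → sumF f ≡ sum f
  sumF≡sum {zero}  f = ≡.refl
  sumF≡sum {suc n} f = ≡.cong (f fz +_) (sumF≡sum (f ∘ fs))

  sumF-cong : ∀ {n} {f g : Vector n} → (∀ i → f i ≈ g i) → sumF f ≈ sumF g
  sumF-cong {f = f} {g} f≈g = begin
    sumF f   ≡⟨ sumF≡sum f ⟩
    sum f    ≈⟨ sum-cong-≋ f≈g ⟩
    sum g    ≡⟨ sumF≡sum g ⟨
    sumF g   ∎

  *-distribˡ-sumF : ∀ {n} x (f : Vector n) → x * sumF f ≈ sumF (λ i → x * f i)
  *-distribˡ-sumF x f = begin
    x * sumF f                ≡⟨ ≡.cong (x *_) (sumF≡sum f) ⟩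
    x * sum f                 ≈⟨ *-distribˡ-sum x f ⟩
    sum (λ i → x * f i)       ≡⟨ sumF≡sum (λ i → x * f i) ⟨
    sumF (λ i → x * f i)      ∎

  *-distribʳ-sumF : ∀ {n} x (f : Vector n) → sumF f * x ≈ sumF (λ i → f i * x)
  *-distribʳ-sumF x f = begin
    sumF f * x                ≡⟨ ≡.cong (_* x) (sumF≡sum f) ⟩
    sum f * x                 ≈⟨ *-distribʳ-sum x f ⟩
    sum (λ i → f i * x)       ≡⟨ sumF≡sum (λ i → f i * x) ⟨
    sumF (λ i → f i * x)      ∎

  sumF-comm : ∀ {m n} (f : Fin m → Fin n → Carrier) →
              sumF (λ i → sumF (f i)) ≈ sumF (λ j → sumF (λ i → f i j))
  sumF-comm f = begin
    sumF (λ i → sumF (f i))                 ≡⟨ sumF≡sum (λ i → sumF (f i)) ⟩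
    sum (λ i → sumF (f i))                  ≈⟨ sum-cong-≋ (λ i → reflexive (sumF≡sum (f i))) ⟩
    sum (λ i → sum (f i))                   ≈⟨ ∑-comm f ⟩
    sum (λ j → sum (λ i → f i j))           ≈⟨ sum-cong-≋ (λ j → reflexive (sumF≡sum (λ i → f i j))) ⟨
    sum (λ j → sumF (λ i → f i j))          ≡⟨ sumF≡sum (λ j → sumF (λ i → f i j)) ⟨
    sumF (λ j → sumF (λ i → f i j))         ∎

  x≤x+y : ∀ {x y} → 0# ≤ y → x ≤ (x + y)
  x≤x+y {x} {y} 0≤y = ≤-resp-≈ (+-identityˡ x) (+-comm y x) (+-mono-≤ x 0≤y)

  sumF-nonneg : ∀ {n} (f : Vector n) → (∀ i → 0# ≤ f i) → 0# ≤ sumF f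
  sumF-nonneg {zero}  f f≥0 = ≤-refl
  sumF-nonneg {suc n} f f≥0 = ≤-trans (f≥0 fz) (x≤x+y (sumF-nonneg (f ∘ fs) (f≥0 ∘ fs)))

  term≤sumF : ∀ {n} (f : Vector n) → (∀ i → 0# ≤ f i) → ∀ k → f k ≤ sumF f
  term≤sumF f f≥0 fz     = x≤x+y (sumF-nonneg (f ∘ fs) (f≥0 ∘ fs))
  term≤sumF f f≥0 (fs k) =
    ≤-trans (term≤sumF (f ∘ fs) (f≥0 ∘ fs) k) (≤-resp-≈ refl (+-comm _ _) (x≤x+y (f≥0 fz)))

  nonneg-sumF≈0⇒≈0 : ∀ {n} (f : Vector n) → (∀ i → 0# ≤ f i) → sumF f ≈ 0# → ∀ k → f k ≈ 0#
  nonneg-sumF≈0⇒≈0 f f≥0 Σf≈0 k = ≤-antisym (≤-resp-≈ refl Σf≈0 (term≤sumF f f≥0 k)) (f≥0 k)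

  IsSymmetric : ∀ {n} → Matrix n → Set ℓ
  IsSymmetric M = ∀ u v → M u v ≈ M v u

  ·-transpose : ∀ {n} {M N : Matrix n} → IsSymmetric M → IsSymmetric N →
                ∀ v w → (M · N) v w ≈ (N · M) w v
  ·-transpose M-sym N-sym v w =
    sumF-cong (λ k → trans (*-cong (M-sym v k) (N-sym k w)) (*-comm _ _))

  adjacency-symmetric : ∀ {n} (G : Graph n) → IsSymmetric (adjacency G)
  adjacency-symmetric G u v with Graph.~-dec G u v | Graph.~-dec G v u
  ... | yes _   | yes _   = refl
  ... | no _    | no _    = refl
  ... | yes u~v | no v≁u  = ⊥-elim (v≁u (Graph.~-sym G u~v))
  ... | no u≁v  | yes v~u = ⊥-elim (u≁v (Graph.~-sym G v~u))

  module _ {n m : ℕ} (P : Partition n m) where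
    open Partition P

    inPart-≡ : ∀ {u j} → part u ≡ j → inPart P u j ≈ 1#
    inPart-≡ {u} {j} e with part u ≟ j
    ... | yes _ = refl
    ... | no  ≢ = ⊥-elim (≢ e)

    inPart-≢ : ∀ {u j} → ¬ part u ≡ j → inPart P u j ≈ 0#
    inPart-≢ {u} {j} ≢ with part u ≟ j
    ... | yes e = ⊥-elim (≢ e)
    ... | no  _ = refl

    inPart-restrict : ∀ {j} {f g : Vector n} → (∀ u → part u ≡ j → f u ≈ g u) →
                      ∀ u → inPart P u j * f u ≈ inPart P u j * g u
    inPart-restrict {j} f≈g u with part u ≟ j
    ... | yes e = *-congˡ (f≈g u e)
    ... | no  _ = trans (zeroˡ _) (sym (zeroˡ _))

    module _ (ν : Vector n) where

      normSq-nonzero : (∀ u → 0# < ν u) → ∀ i → ¬ normSq P ν i ≈ 0#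
      normSq-nonzero ν>0 i Nᵢ≈0 with nonempty i
      ... | u , uᵢ = *-nonzero (ν≉0 u) (ν≉0 u) (begin
        ν u * ν u                    ≈⟨ *-identityˡ _ ⟨
        1# * (ν u * ν u)             ≈⟨ *-congʳ (inPart-≡ uᵢ) ⟨
        inPart P u i * (ν u * ν u)   ≈⟨ nonneg-sumF≈0⇒≈0 _ term-nonneg Nᵢ≈0 u ⟩
        0#                           ∎)
        where
        ν≉0 : ∀ u → ¬ ν u ≈ 0#
        ν≉0 u ν≈0 = proj₂ (ν>0 u) (sym ν≈0)

        term-nonneg : ∀ u → 0# ≤ (inPart P u i * (ν u * ν u))
        term-nonneg u with part u ≟ i
        ... | yes _ = ≤-resp-≈ refl (sym (*-identityˡ _)) (*-nonneg (proj₁ (ν>0 u)) (proj₁ (ν>0 u)))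
        ... | no  _ = ≤-resp-≈ refl (sym (zeroˡ _)) ≤-refl

      XP-symmetric : IsSymmetric (XP P ν)
      XP-symmetric v w with part v ≟ part w | part w ≟ part v
      ... | yes e | yes _ = *-cong (*-comm (ν v) (ν w)) (reflexive (≡.cong (λ j → normSq P ν j ⁻¹) e))
      ... | no  _ | no  _ = refl
      ... | yes e | no  ≢ = ⊥-elim (≢ (≡.sym e))
      ... | no  ≢ | yes e = ⊥-elim (≢ (≡.sym e))

      XP-inPart : ∀ v k → XP P ν v k ≈ inPart P k (part v) * ((ν v * ν k) / normSq P ν (part v))
      XP-inPart v k with part v ≟ part k
      ... | yes e = trans (sym (*-identityˡ _)) (*-congʳ (sym (inPart-≡ (≡.sym e))))
      ... | no  ≢ = trans (sym (zeroˡ _)) (*-congʳ (sym (inPart-≢ (≢ ∘ ≡.sym))))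

  module _ {n m : ℕ} (G : Graph n) (P : Partition n m) (ν : Vector n) where
    open Partition P

    private
      A : Matrix n
      A = adjacency G

      N : Fin m → Carrier
      N = normSq P ν

      b : Fin n → Fin m → Carrier
      b = weightIntersection P G ν

    neighbourWeight : Fin n → Fin m → Carrier
    neighbourWeight u j = sumF (λ x → inPart P x j * (A u x * ν x))

    edgeWeight : Fin m → Fin m → Carrier
    edgeWeight i j = sumF (λ u → sumF (λ x → (inPart P u i * inPart P x j) * (A u x * (ν u * ν x))))

    edgeWeight-sym : ∀ i j → edgeWeight i j ≈ edgeWeight j i
    edgeWeight-sym i j = trans (sumF-comm {n} {n} _) (sumF-cong λ x → sumF-cong λ u →
      *-cong (*-comm _ _) (*-cong (adjacency-symmetric G u x) (*-comm (ν u) (ν x))))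

    module _ (ν>0 : ∀ u → 0# < ν u) where

      ν*weightIntersection : ∀ u j → ν u * b u j ≈ neighbourWeight u j
      ν*weightIntersection u j = x*[y/x]≈y (neighbourWeight u j) (λ ν≈0 → proj₂ (ν>0 u) (sym ν≈0))

      XP·adjacency : ∀ v w → (XP P ν · A) v w ≈ (ν v * ν w) * (b w (part v) / N (part v))
      XP·adjacency v w = begin
        sumF (λ k → XP P ν v k * A k w)
          ≈⟨ sumF-cong (λ k → *-cong (XP-inPart P ν v k) (adjacency-symmetric G k w)) ⟩
        sumF (λ k → inPart P k i * ((ν v * ν k) * N i ⁻¹) * A w k)
          ≈⟨ sumF-cong (λ k → solve 5 (λ p a c d e → (p ⊕ ((a ⊕ c) ⊕ d)) ⊕ e ⊜ (a ⊕ d) ⊕ (p ⊕ (e ⊕ c)))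
                                      refl (inPart P k i) (ν v) (ν k) (N i ⁻¹) (A w k)) ⟩
        sumF (λ k → (ν v * N i ⁻¹) * (inPart P k i * (A w k * ν k)))
          ≈⟨ *-distribˡ-sumF {n} (ν v * N i ⁻¹) _ ⟨
        (ν v * N i ⁻¹) * neighbourWeight w i
          ≈⟨ *-congˡ (ν*weightIntersection w i) ⟨
        (ν v * N i ⁻¹) * (ν w * b w i)
          ≈⟨ solve 4 (λ a d c e → (a ⊕ d) ⊕ (c ⊕ e) ⊜ (a ⊕ c) ⊕ (e ⊕ d)) refl (ν v) (N i ⁻¹) (ν w) (b w i) ⟩
        (ν v * ν w) * (b w i / N i) ∎
        where
        i : Fin m
        i = part v

      inPart*neighbourWeight : ∀ u i j →
        inPart P u i * (ν u * neighbourWeight u j) ≈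
        sumF (λ x → (inPart P u i * inPart P x j) * (A u x * (ν u * ν x)))
      inPart*neighbourWeight u i j = begin
        inPart P u i * (ν u * neighbourWeight u j)
          ≈⟨ *-congˡ (*-distribˡ-sumF {n} (ν u) _) ⟩
        inPart P u i * sumF (λ x → ν u * (inPart P x j * (A u x * ν x)))
          ≈⟨ *-distribˡ-sumF {n} (inPart P u i) _ ⟩
        sumF (λ x → inPart P u i * (ν u * (inPart P x j * (A u x * ν x))))
          ≈⟨ sumF-cong (λ x → solve 5 (λ p a q e c → p ⊕ (a ⊕ (q ⊕ (e ⊕ c))) ⊜ (p ⊕ q) ⊕ (e ⊕ (a ⊕ c)))
                                      refl (inPart P u i) (ν u) (inPart P x j) (A u x) (ν x)) ⟩
        sumF (λ x → (inPart P u i * inPart P x j) * (A u x * (ν u * ν x))) ∎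

      normSq*weightIntersection : IsWeightEquitable P G ν →
        ∀ {i} w j → part w ≡ i → N i * b w j ≈ edgeWeight i j
      normSq*weightIntersection equitable {i} w j wᵢ = begin
        N i * b w j
          ≈⟨ *-distribʳ-sumF {n} (b w j) _ ⟩
        sumF (λ u → inPart P u i * (ν u * ν u) * b w j)
          ≈⟨ sumF-cong {n} (λ u → *-assoc _ _ _) ⟩
        sumF (λ u → inPart P u i * (ν u * ν u * b w j))
          ≈⟨ sumF-cong (inPart-restrict P λ u uᵢ → *-congˡ (equitable w u j (≡.trans wᵢ (≡.sym uᵢ)))) ⟩
        sumF (λ u → inPart P u i * (ν u * ν u * b u j))
          ≈⟨ sumF-cong (λ u → *-congˡ (trans (*-assoc _ _ _) (*-congˡ (ν*weightIntersection u j)))) ⟩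
        sumF (λ u → inPart P u i * (ν u * neighbourWeight u j))
          ≈⟨ sumF-cong (λ u → inPart*neighbourWeight u i j) ⟩
        edgeWeight i j ∎

      weightIntersection/normSq-sym : IsWeightEquitable P G ν →
        ∀ v w → b w (part v) / N (part v) ≈ b v (part w) / N (part w)
      weightIntersection/normSq-sym equitable v w =
        /-cross (normSq-nonzero P ν ν>0 i) (normSq-nonzero P ν ν>0 j) (begin
          b w i * N j       ≈⟨ *-comm _ _ ⟩
          N j * b w i       ≈⟨ normSq*weightIntersection equitable w i ≡.refl ⟩
          edgeWeight j i    ≈⟨ edgeWeight-sym j i ⟩
          edgeWeight i j    ≈⟨ normSq*weightIntersection equitable v j ≡.refl ⟨
          N i * b v j       ≈⟨ *-comm _ _ ⟩
          b v j * N i       ∎)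
        where
        i j : Fin m
        i = part v
        j = part w

proposition4p1 : ∀ {c ℓ : Level} (ℝ : CompleteOrderedField c ℓ) (n m : ℕ) (G : Graph n) → Connected G → (ν : LinAlg.Vector ℝ n) → LinAlg.IsPerronEigenvector ℝ G ν → (P : Partition n m) → LinAlg.IsWeightEquitable ℝ P G ν → ∀ v w → CompleteOrderedField._≈_ ℝ (LinAlg._·_ ℝ (LinAlg.XP ℝ P ν) (LinAlg.adjacency ℝ G) v w) (LinAlg._·_ ℝ (LinAlg.adjacency ℝ G) (LinAlg.XP ℝ P ν) v w)
proposition4p1 ℝ n m G _ ν (_ , _ , _ , ν>0 , _) P equitable v w = begin
  (X · A) v w                          ≈⟨ XP·adjacency ℝ G P ν ν>0 v w ⟩
  (ν v * ν w) * (b w i / N i)          ≈⟨ *-cong (*-comm (ν v) (ν w)) (weightIntersection/normSq-sym ℝ G P ν ν>0 equitable v w) ⟩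
  (ν w * ν v) * (b v j / N j)          ≈⟨ XP·adjacency ℝ G P ν ν>0 w v ⟨
  (X · A) w v                          ≈⟨ ·-transpose ℝ (XP-symmetric ℝ P ν) (adjacency-symmetric ℝ G) w v ⟩
  (A · X) v w                          ∎
  where
  open CompleteOrderedField ℝ
  open LinAlg ℝ
  open import Relation.Binary.Reasoning.Setoid setoid
  A X : Matrix n
  A = adjacency G
  X = XP P ν

  N : Fin m → Carrier
  N = normSq P ν

  b : Fin n → Fin m → Carrier
  b = weightIntersection P G ν

  i j : Fin m
  i = Partition.part P v
  j = Partition.part P w
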